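{- Let $n$ be a positive even integer. If $G$ is a connected graph of order $n$ with minimum degree $\delta(G)\geq \frac{n}{2}+1$, then $G$ has an odd spanning tree.
   Context: All graphs are finite and simple. An odd spanning tree of $G$ is a spanning tree of $G$ in which every vertex has odd degree. -}

module Defs where

open import Data.Nat using (ℕ; zero; suc; _+_; _*_; _≤_; _<_)
open import Data.Fin using (Fin)
open import Data.Bool using (Bool; true; false)
open import Data.List using (List; []; _∷_; length; filter)
open import Data.List.Relation.Unary.Unique.Propositional using (Unique)
open import Data.Product using (Σ; _×_; ∃-syntax)
open import Relation.Binary.PropositionalEquality using (_≡_)
open import Data.Nat using (_%_)
open import Data.List using (allFin; last)
open import Data.Maybe using (just)
open import Data.Empty using (⊥)
open import Data.Bool using (_≟_)

record Graph (n : ℕ) : Set where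
  field
    adj   : Fin n → Fin n → Bool
    sym   : ∀ u v → adj u v ≡ adj v u
    irref : ∀ v → adj v v ≡ false
open Graph public

degree : ∀ {n} → Graph n → Fin n → ℕ
degree {n} G v = length (filter (λ u → adj G v u ≟ true) (allFin n))

MinDegreeAtLeast : ∀ {n} → Graph n → ℕ → Set
MinDegreeAtLeast G d = ∀ v → d ≤ degree G v

data Walk {n} (G : Graph n) : Fin n → Fin n → Set where
  [_]  : ∀ v → Walk G v v
  _∷ʷ_ : ∀ {u w v} → adj G u w ≡ true → Walk G w v → Walk G u v

Connected : ∀ {n} → Graph n → Set
Connected G = ∀ u v → Walk G u v

data IsPath {n} (G : Graph n) : List (Fin n) → Set where
  one  : ∀ v → IsPath G (v ∷ [])
  cons : ∀ {u w vs} → adj G u w ≡ true → IsPath G (w ∷ vs) → IsPath G (u ∷ w ∷ vs)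

record Cycle {n} (G : Graph n) : Set where
  field
    v₀ vₖ      : Fin n
    rest       : List (Fin n)
    verts      : List (Fin n)
    shape      : verts ≡ v₀ ∷ rest
    long       : 3 ≤ length verts
    distinct   : Unique verts
    path       : IsPath G verts
    lastOf     : last verts ≡ just vₖ
    closing    : adj G vₖ v₀ ≡ true

Acyclic : ∀ {n} → Graph n → Set
Acyclic G = Cycle G → ⊥

IsTree : ∀ {n} → Graph n → Set
IsTree G = Connected G × Acyclic G

SpanningSubgraph : ∀ {n} → Graph n → Graph n → Set
SpanningSubgraph {n} H G = ∀ (u v : Fin n) → adj H u v ≡ true → adj G u v ≡ true

Odd : ℕ → Set
Odd d = d % 2 ≡ 1

HasOddSpanningTree : ∀ {n} → Graph n → Set
HasOddSpanningTree {n} G =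
  Σ (Graph n) λ T → SpanningSubgraph T G × IsTree T × (∀ v → Odd (degree T v))

-- Root the tree at a vertex u and grow it greedily, keeping every degree odd.
-- Start with the star from u to an odd number (at least n/2) of its neighbours;
-- then, while m > 0 vertices lie outside the tree (m stays even), hang two new
-- leaves x, y below a tree vertex s adjacent to both, which keeps the degree of
-- s odd. Such an s exists: otherwise every tree vertex has at most one
-- neighbour outside, while every outside vertex, having degree at least
-- n/2 + 1, has at least n/2 + 2 - m neighbours inside, and double counting the
-- edges between the two sides gives m (n/2 + 2 - m) ≤ n - m, which fails for
-- 2 ≤ m < n/2. The tree is kept as a parent function whose rank strictly
-- decreases towards the root, which makes it connected and acyclic.

module Submission where

open import Defs renaming (sym to adj-sym)

open import Data.Bool using (Bool; true; false; not; _∧_; _∨_; if_then_else_) renaming (_≟_ to _≟ᵇ_)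
open import Data.Bool.Properties
  using (not-involutive; ∧-comm; ∨-comm; ∨-identityʳ; ∨-zeroʳ; ∧-identityʳ; ∧-zeroʳ)
open import Data.Empty using (⊥; ⊥-elim)
open import Data.Fin using (Fin; zero; suc; _≟_)
open import Data.Fin.Properties using (any?) renaming (suc-injective to Fin-suc-injective)
open import Data.List using (List; []; _∷_; _++_; filter; length; tabulate; last)
open import Data.List.Membership.Propositional using (_∈_)
open import Data.List.Membership.Propositional.Properties using (∈-++⁺ʳ)
open import Data.List.Relation.Unary.All as All using (All; []; _∷_)
open import Data.List.Relation.Unary.AllPairs using ([]; _∷_)
open import Data.List.Relation.Unary.Any using (here; there)
open import Data.List.Relation.Unary.Unique.Propositional using (Unique)
open import Data.Maybe using (just)
open import Data.Nat using (ℕ; zero; suc; _+_; _*_; _≤_; _<_; z≤n; s≤s; z<s; _≤?_; _%_; _/_)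
open import Data.Nat.DivMod using ([m+kn]%n≡m%n; %-distribˡ-+; m%n<n; m≡m%n+[m/n]*n)
open import Data.Nat.Properties hiding (_≟_)
open import Algebra.Properties.Semiring.Sum +-*-semiring
  using (sum-syntax; sum-cong-≗; ∑-distrib-+; ∑-comm; *-distribˡ-sum; *-distribʳ-sum; sum-replicate-zero)
open import Data.Nat.Tactic.RingSolver using (solve-∀)
open import Data.Product using (Σ; _×_; _,_; ∃-syntax; proj₂)
open import Data.Sum using (_⊎_; inj₁; inj₂)
open import Data.Unit using (⊤; tt)
open import Function using (id; _∘_)
open import Relation.Binary.PropositionalEquality
open import Relation.Nullary using (¬_; does; yes; no)
open import Relation.Nullary.Decidable using (dec-true; dec-false; _×-dec_)

toℕ : Bool → ℕ
toℕ false = 0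
toℕ true  = 1

count : ∀ {n} → (Fin n → Bool) → ℕ
count {n} P = ∑[ i < n ] toℕ (P i)

_==_ : ∀ {n} → Fin n → Fin n → Bool
x == y = does (x ≟ y)

==-refl : ∀ {n} (x : Fin n) → (x == x) ≡ true
==-refl x = dec-true (x ≟ x) refl

==-≢ : ∀ {n} {x y : Fin n} → x ≢ y → (x == y) ≡ false
==-≢ {x = x} {y} = dec-false (x ≟ y)

==⇒≡ : ∀ {n} {x y : Fin n} → (x == y) ≡ true → x ≡ y
==⇒≡ {x = x} {y} eq with x ≟ y
... | yes x≡y = x≡y

true≢false : true ≢ false
true≢false ()

∧-true⇒ : ∀ {a b} → a ∧ b ≡ true → a ≡ true × b ≡ true
∧-true⇒ {true} {true} _ = refl , refl

not-true⇒ : ∀ {a} → not a ≡ true → a ≡ false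
not-true⇒ {false} _ = refl

==-false⇒≢ : ∀ {n} {x y : Fin n} → (x == y) ≡ false → x ≢ y
==-false⇒≢ {x = x} {y} eq with x ≟ y
... | no x≢y = x≢y

toℕ-∧ : ∀ x y → toℕ (x ∧ y) ≡ toℕ x * toℕ y
toℕ-∧ false y = refl
toℕ-∧ true  y = sym (+-identityʳ (toℕ y))

count-cong : ∀ {n} {P Q : Fin n → Bool} → (∀ i → P i ≡ Q i) → count P ≡ count Q
count-cong P≗Q = sum-cong-≗ (λ i → cong toℕ (P≗Q i))

count-false : ∀ n → count {n} (λ _ → false) ≡ 0
count-false n = sum-replicate-zero n

count-true : ∀ n → count {n} (λ _ → true) ≡ n
count-true zero    = refl
count-true (suc n) = cong suc (count-true n)

count-== : ∀ {n} (a : Fin n) → count (_== a) ≡ 1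
count-== {suc n} zero    = cong suc (count-false n)
count-== {suc n} (suc a) = trans (count-cong suc==suc) (count-== a)
  where
  suc==suc : ∀ i → (suc i == suc a) ≡ (i == a)
  suc==suc i with i ≟ a
  ... | yes _ = refl
  ... | no  _ = refl

count-split : ∀ {n} (P Q : Fin n → Bool) →
  count Q ≡ count (λ i → Q i ∧ P i) + count (λ i → Q i ∧ not (P i))
count-split P Q =
  trans (sum-cong-≗ split) (∑-distrib-+ (λ i → toℕ (Q i ∧ P i)) (λ i → toℕ (Q i ∧ not (P i))))
  where
  split : ∀ i → toℕ (Q i) ≡ toℕ (Q i ∧ P i) + toℕ (Q i ∧ not (P i))
  split i with Q i | P i
  ... | false | _     = refl
  ... | true  | true  = refl
  ... | true  | false = refl

count-complement : ∀ {n} (P : Fin n → Bool) → count P + count (λ i → not (P i)) ≡ n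
count-complement {n} P = trans (sym (count-split P (λ _ → true))) (count-true n)

count-∨ : ∀ {n} {P Q : Fin n → Bool} → (∀ i → P i ∧ Q i ≡ false) →
  count (λ i → P i ∨ Q i) ≡ count P + count Q
count-∨ {P = P} {Q} disjoint = trans (sum-cong-≗ split) (∑-distrib-+ (toℕ ∘ P) (toℕ ∘ Q))
  where
  split : ∀ i → toℕ (P i ∨ Q i) ≡ toℕ (P i) + toℕ (Q i)
  split i with P i | Q i | disjoint i
  ... | false | _     | _  = refl
  ... | true  | false | _  = refl

toℕ-*-count : ∀ {n} b (P : Fin n → Bool) → toℕ b * count P ≡ count (λ i → b ∧ P i)
toℕ-*-count {n} false P = sym (count-false n)
toℕ-*-count       true  P = +-identityʳ (count P)

count≡0⇒ : ∀ {n} (P : Fin n → Bool) → count P ≡ 0 → ∀ i → P i ≡ false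
count≡0⇒ P eq zero with P zero
... | false = refl
count≡0⇒ P eq (suc i) with P zero
... | false = count≡0⇒ (λ j → P (suc j)) eq i

count-witness : ∀ {n} (P : Fin n → Bool) {i} → P i ≡ true → 1 ≤ count P
count-witness P {zero} Pi rewrite Pi = s≤s z≤n
count-witness P {suc i} Pi = ≤-trans (count-witness (λ j → P (suc j)) Pi) (m≤n+m _ (toℕ (P zero)))

count≥1⇒ : ∀ {n} (P : Fin n → Bool) → 1 ≤ count P → ∃[ i ] P i ≡ true
count≥1⇒ {suc n} P 1≤c with P zero in P0
... | true  = zero , P0
... | false = let i , Pi = count≥1⇒ (λ j → P (suc j)) 1≤c in suc i , Pi

count≥2⇒ : ∀ {n} (P : Fin n → Bool) → 2 ≤ count P →
  Σ (Fin n) λ i → Σ (Fin n) λ j → i ≢ j × P i ≡ true × P j ≡ true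
count≥2⇒ {suc n} P 2≤c with P zero in P0
... | true  = let j , Pj = count≥1⇒ (λ j → P (suc j)) (≤-pred 2≤c) in zero , suc j , (λ ()) , P0 , Pj
... | false = let i , j , i≢j , Pi , Pj = count≥2⇒ (λ j → P (suc j)) 2≤c
              in suc i , suc j , (λ eq → i≢j (Fin-suc-injective eq)) , Pi , Pj

degree≡count : ∀ {n} (G : Graph n) v → degree G v ≡ count (adj G v)
degree≡count {n} G v = length-filter-tabulate id
  where
  length-filter-tabulate : ∀ {m} (f : Fin m → Fin n) →
    length (filter (λ u → adj G v u ≟ᵇ true) (tabulate f)) ≡ count (λ i → adj G v (f i))
  length-filter-tabulate {zero}  f = refl
  length-filter-tabulate {suc m} f with adj G v (f zero)
  ... | true  = cong suc (length-filter-tabulate (λ i → f (suc i)))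
  ... | false = length-filter-tabulate (λ i → f (suc i))

∑-mono-≤ : ∀ {n} {f g : Fin n → ℕ} → (∀ i → f i ≤ g i) → ∑[ i < n ] f i ≤ ∑[ i < n ] g i
∑-mono-≤ {zero}  f≤g = z≤n
∑-mono-≤ {suc n} f≤g = +-mono-≤ (f≤g zero) (∑-mono-≤ (λ i → f≤g (suc i)))

suc-even⇒odd : ∀ m → suc m % 2 ≡ 0 → Odd m
suc-even⇒odd m even with m % 2 in m%2 | m%n<n m 2
... | 1           | _               = refl
... | 0           | _               =
  ⊥-elim (0≢1+n (trans (sym even) (trans (%-distribˡ-+ 1 m 2) (cong (λ r → (1 + r) % 2) m%2))))
... | suc (suc _) | s≤s (s≤s ())

odd⇒suc-double : ∀ {m} → Odd m → ∃[ j ] suc m ≡ j + j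
odd⇒suc-double {m} odd = suc (m / 2) , (begin
  suc m                       ≡⟨ cong suc (m≡m%n+[m/n]*n m 2) ⟩
  suc (m % 2 + m / 2 * 2)     ≡⟨ cong (λ r → suc (r + m / 2 * 2)) odd ⟩
  2 + m / 2 * 2               ≡⟨ double (m / 2) ⟩
  suc (m / 2) + suc (m / 2)   ∎)
  where
  open ≡-Reasoning
  double : ∀ q → 2 + q * 2 ≡ suc q + suc q
  double = solve-∀

even⇒double : ∀ {m} → m % 2 ≡ 0 → m ≡ m / 2 + m / 2
even⇒double {m} even = trans (m≡m%n+[m/n]*n m 2) (trans (cong (_+ m / 2 * 2) even) (double (m / 2)))
  where
  double : ∀ q → 0 + q * 2 ≡ q + q
  double = solve-∀

double-suc : ∀ k → suc k + suc k ≡ k + k + 2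
double-suc = solve-∀

+-double-cancel : ∀ a j c → a + (j + j) ≡ c + c → ∃[ k ] a ≡ k + k
+-double-cancel a zero    c       eq = c , trans (sym (+-identityʳ a)) eq
+-double-cancel a (suc j) zero    eq = ⊥-elim (m+1+n≢0 a eq)
+-double-cancel a (suc j) (suc c) eq =
  +-double-cancel a j c (suc-injective (suc-injective (trans (sym (shift a j)) (trans eq (shift 0 c)))))
  where
  shift : ∀ a j → a + (suc j + suc j) ≡ suc (suc (a + (j + j)))
  shift = solve-∀

odd-subset : ∀ {n} (P : Fin n → Bool) → 1 ≤ count P →
  ∃[ Q ] (∀ i → Q i ≡ true → P i ≡ true) × Odd (count Q) × count P ≤ suc (count Q)
odd-subset P 1≤P with count P % 2 in parity | m%n<n (count P) 2
... | 1           | _ = P , (λ _ Pi → Pi) , parity , n≤1+n (count P)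
... | suc (suc _) | s≤s (s≤s ())
... | 0           | _ with count≥1⇒ P 1≤P
...   | w , Pw =
  Q , Q⊆P , suc-even⇒odd (count Q) (subst (λ c → c % 2 ≡ 0) size parity) , ≤-reflexive size
  where
  Q : _ → Bool
  Q i = P i ∧ not (i == w)
  Q⊆P : ∀ i → Q i ≡ true → P i ≡ true
  Q⊆P i Qi with P i
  ... | true = refl
  only-w : ∀ i → P i ∧ (i == w) ≡ (i == w)
  only-w i with i == w in i=w
  ... | false = ∧-zeroʳ (P i)
  ... | true rewrite ==⇒≡ {x = i} {w} i=w = trans (∧-identityʳ (P w)) Pw
  size : count P ≡ suc (count Q)
  size = trans (count-split (_== w) P) (cong (_+ count Q) (trans (count-cong only-w) (count-== w)))

-- Double counting edges between vertex sets

module _ {n} (G : Graph n) where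

  degreeIn : (Fin n → Bool) → Fin n → ℕ
  degreeIn A v = count (λ u → adj G v u ∧ A u)

  crossEdges : (Fin n → Bool) → (Fin n → Bool) → ℕ
  crossEdges A B = ∑[ a < n ] (toℕ (A a) * degreeIn B a)

  degree≡degreeIn+degreeIn : ∀ (A : Fin n → Bool) v →
    degree G v ≡ degreeIn A v + degreeIn (λ u → not (A u)) v
  degree≡degreeIn+degreeIn A v = trans (degree≡count G v) (count-split A (adj G v))

  degreeIn< : ∀ {A : Fin n → Bool} {v} → A v ≡ true → degreeIn A v < count A
  degreeIn< {A} {v} Av = begin-strict
    degreeIn A v
      ≡⟨ count-cong (λ u → ∧-comm (adj G v u) (A u)) ⟩
    count (λ u → A u ∧ adj G v u)
      <⟨ m<m+n _ (count-witness (λ u → A u ∧ not (adj G v u)) v∉N[v]) ⟩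
    count (λ u → A u ∧ adj G v u) + count (λ u → A u ∧ not (adj G v u))
      ≡⟨ count-split (adj G v) A ⟨
    count A ∎
    where
    open ≤-Reasoning
    v∉N[v] : A v ∧ not (adj G v v) ≡ true
    v∉N[v] rewrite Av | irref G v = refl

  crossEdges-comm : ∀ A B → crossEdges A B ≡ crossEdges B A
  crossEdges-comm A B = begin
    ∑[ a < n ] (toℕ (A a) * ∑[ b < n ] toℕ (adj G a b ∧ B b))
      ≡⟨ sum-cong-≗ (λ a → *-distribˡ-sum (toℕ (A a)) (λ b → toℕ (adj G a b ∧ B b))) ⟩
    ∑[ a < n ] ∑[ b < n ] (toℕ (A a) * toℕ (adj G a b ∧ B b))
      ≡⟨ ∑-comm (λ a b → toℕ (A a) * toℕ (adj G a b ∧ B b)) ⟩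
    ∑[ b < n ] ∑[ a < n ] (toℕ (A a) * toℕ (adj G a b ∧ B b))
      ≡⟨ sum-cong-≗ (λ b → sum-cong-≗ (λ a → swap a b)) ⟩
    ∑[ b < n ] ∑[ a < n ] (toℕ (B b) * toℕ (adj G b a ∧ A a))
      ≡⟨ sum-cong-≗ (λ b → *-distribˡ-sum (toℕ (B b)) (λ a → toℕ (adj G b a ∧ A a))) ⟨
    ∑[ b < n ] (toℕ (B b) * ∑[ a < n ] toℕ (adj G b a ∧ A a)) ∎
    where
    open ≡-Reasoning
    swap : ∀ a b → toℕ (A a) * toℕ (adj G a b ∧ B b) ≡ toℕ (B b) * toℕ (adj G b a ∧ A a)
    swap a b rewrite toℕ-∧ (adj G a b) (B b) | toℕ-∧ (adj G b a) (A a) | adj-sym G a b =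
      rearrange (toℕ (A a)) (toℕ (adj G b a)) (toℕ (B b))
      where
      rearrange : ∀ x y z → x * (y * z) ≡ z * (y * x)
      rearrange = solve-∀

  crossEdges≤count : ∀ A B → (∀ a → A a ≡ true → degreeIn B a ≤ 1) → crossEdges A B ≤ count A
  crossEdges≤count A B bounded = ∑-mono-≤ pointwise
    where
    pointwise : ∀ a → toℕ (A a) * degreeIn B a ≤ toℕ (A a)
    pointwise a with A a in Aa
    ... | false = z≤n
    ... | true  = ≤-trans (≤-reflexive (+-identityʳ _)) (bounded a Aa)

  count*≤crossEdges : ∀ A B {k l} → (∀ b → B b ≡ true → k ≤ degreeIn A b + l) →
    count B * k ≤ crossEdges B A + count B * l
  count*≤crossEdges A B {k} {l} bounded = begin
    count B * k
      ≡⟨ *-distribʳ-sum k (toℕ ∘ B) ⟩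
    ∑[ b < n ] (toℕ (B b) * k)
      ≤⟨ ∑-mono-≤ pointwise ⟩
    ∑[ b < n ] (toℕ (B b) * degreeIn A b + toℕ (B b) * l)
      ≡⟨ ∑-distrib-+ (λ b → toℕ (B b) * degreeIn A b) (λ b → toℕ (B b) * l) ⟩
    crossEdges B A + ∑[ b < n ] (toℕ (B b) * l)
      ≡⟨ cong (crossEdges B A +_) (*-distribʳ-sum l (toℕ ∘ B)) ⟨
    crossEdges B A + count B * l ∎
    where
    open ≤-Reasoning
    pointwise : ∀ b → toℕ (B b) * k ≤ toℕ (B b) * degreeIn A b + toℕ (B b) * l
    pointwise b with B b in Bb
    ... | false = z≤n
    ... | true rewrite *-identityˡ k | *-identityˡ (degreeIn A b) | *-identityˡ l = bounded b Bb

c+m*m<m*[h+2] : ∀ {m h c} → 2 ≤ m → m + 1 ≤ h → c + m ≡ h + h → c + m * m < m * (h + 2)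
c+m*m<m*[h+2] {m} {h} {c} 2≤m m+1≤h c+m≡h+h
  with m≤n⇒∃[o]m+o≡n 2≤m | m≤n⇒∃[o]m+o≡n m+1≤h
... | a , refl | e , refl = begin-strict
  c + (2 + a) * (2 + a)                                          ≡⟨ cong (_+ (2 + a) * (2 + a)) c≡ ⟩
  4 + a + 2 * e + (2 + a) * (2 + a)                              <⟨ m<m+n _ z<s ⟩
  4 + a + 2 * e + (2 + a) * (2 + a) + suc (1 + 2 * a + a * e)   ≡⟨ expand a e ⟩
  (2 + a) * (2 + a + 1 + e + 2)                                  ∎
  where
  open ≤-Reasoning
  double : ∀ a e → (2 + a + 1 + e) + (2 + a + 1 + e) ≡ (4 + a + 2 * e) + (2 + a)
  double = solve-∀
  expand : ∀ a e →
    4 + a + 2 * e + (2 + a) * (2 + a) + suc (1 + 2 * a + a * e) ≡ (2 + a) * (2 + a + 1 + e + 2)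
  expand = solve-∀
  c≡ : c ≡ 4 + a + 2 * e
  c≡ = +-cancelʳ-≡ (2 + a) c (4 + a + 2 * e) (trans c+m≡h+h (double a e))

module _ {n} (G : Graph n) {h} (n≡h+h : n ≡ h + h) (δ≥ : MinDegreeAtLeast G (h + 1)) where

  branching-vertex : ∀ (S : Fin n → Bool) → 2 ≤ count (not ∘ S) → count (not ∘ S) + 1 ≤ h →
    ∃[ s ] S s ≡ true × 2 ≤ degreeIn G (not ∘ S) s
  branching-vertex S 2≤m m+1≤h
    with any? (λ s → (S s ≟ᵇ true) ×-dec (2 ≤? degreeIn G (not ∘ S) s))
  ... | yes found = found
  ... | no ¬found = ⊥-elim (<⇒≱ (c+m*m<m*[h+2] 2≤m m+1≤h total) overcount)
    where
    U = not ∘ S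
    m = count U
    total : count S + m ≡ h + h
    total = trans (count-complement S) n≡h+h
    sparse : ∀ s → S s ≡ true → degreeIn G U s ≤ 1
    sparse s Ss = ≤-pred (≰⇒> (λ 2≤d → ¬found (s , Ss , 2≤d)))
    dense : ∀ x → U x ≡ true → h + 2 ≤ degreeIn G S x + m
    dense x Ux = begin
      h + 2                                  ≡⟨ +-assoc h 1 1 ⟨
      h + 1 + 1                              ≤⟨ +-monoˡ-≤ 1 (δ≥ x) ⟩
      degree G x + 1                         ≡⟨ cong (_+ 1) (degree≡degreeIn+degreeIn G S x) ⟩
      degreeIn G S x + degreeIn G U x + 1    ≡⟨ +-assoc (degreeIn G S x) _ 1 ⟩
      degreeIn G S x + (degreeIn G U x + 1)  ≡⟨ cong (degreeIn G S x +_) (+-comm _ 1) ⟩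
      degreeIn G S x + suc (degreeIn G U x)  ≤⟨ +-monoʳ-≤ (degreeIn G S x) (degreeIn< G Ux) ⟩
      degreeIn G S x + m                     ∎
      where open ≤-Reasoning
    overcount : m * (h + 2) ≤ count S + m * m
    overcount = begin
      m * (h + 2)                     ≤⟨ count*≤crossEdges G S U dense ⟩
      crossEdges G U S + m * m        ≡⟨ cong (_+ m * m) (crossEdges-comm G U S) ⟩
      crossEdges G S U + m * m        ≤⟨ +-monoˡ-≤ (m * m) (crossEdges≤count G S U sparse) ⟩
      count S + m * m                 ∎
      where open ≤-Reasoning

module _ {n} {G : Graph n} where

  _∷ʳʷ_ : ∀ {u v w} → Walk G u v → adj G v w ≡ true → Walk G u w
  [ v ]      ∷ʳʷ vw = vw ∷ʷ [ _ ]
  (e ∷ʷ p)   ∷ʳʷ vw = e ∷ʷ (p ∷ʳʷ vw)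

  reverseʷ : ∀ {u v} → Walk G u v → Walk G v u
  reverseʷ [ v ]                 = [ v ]
  reverseʷ (_∷ʷ_ {u} {w} uw p)   = reverseʷ p ∷ʳʷ trans (adj-sym G w u) uw

  _++ʷ_ : ∀ {u v w} → Walk G u v → Walk G v w → Walk G u w
  [ v ]    ++ʷ q = q
  (e ∷ʷ p) ++ʷ q = e ∷ʷ (p ++ʷ q)

  isPath-∷ʳ : ∀ xs {z a} → IsPath G xs → last xs ≡ just z → adj G z a ≡ true → IsPath G (xs ++ a ∷ [])
  isPath-∷ʳ (x ∷ [])     (one x)    refl za = cons za (one _)
  isPath-∷ʳ (x ∷ y ∷ ws) (cons e p) lst  za = cons e (isPath-∷ʳ (y ∷ ws) p lst za)

last⇒∈ : ∀ {A : Set} (xs : List A) {z} → last xs ≡ just z → z ∈ xs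
last⇒∈ (x ∷ [])     refl = here refl
last⇒∈ (x ∷ y ∷ ws) lst  = there (last⇒∈ (y ∷ ws) lst)

NonBacktracking : ∀ {A : Set} → List A → Set
NonBacktracking (a ∷ b ∷ c ∷ ws) = a ≢ c × NonBacktracking (b ∷ c ∷ ws)
NonBacktracking _                = ⊤

unique-∷ʳ-nonBacktracking : ∀ {A : Set} (ys : List A) a → Unique ys → All (a ≢_) ys →
  NonBacktracking (ys ++ a ∷ [])
unique-∷ʳ-nonBacktracking []                a _                   _            = tt
unique-∷ʳ-nonBacktracking (y ∷ [])          a _                   _            = tt
unique-∷ʳ-nonBacktracking (y ∷ y′ ∷ [])     a _                   (a≢y ∷ _)    = ≢-sym a≢y , tt
unique-∷ʳ-nonBacktracking (y ∷ y′ ∷ z ∷ zs) a ((_ ∷ y≢z ∷ _) ∷ u) (_ ∷ a∉)     =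
  y≢z , unique-∷ʳ-nonBacktracking (y′ ∷ z ∷ zs) a u a∉

-- The tree of a parent function

module Parent {n} (r : Fin n) (par : Fin n → Fin n) where

  isChildOf : Fin n → Fin n → Bool
  isChildOf a b = not (a == r) ∧ (b == par a)

  children : Fin n → ℕ
  children v = count (λ a → isChildOf a v)

module ParentTree {n} (G : Graph n) (r : Fin n) (par : Fin n → Fin n) (rk : Fin n → ℕ)
  (par-rk : ∀ v → v ≢ r → rk (par v) < rk v)
  (par-adj : ∀ v → v ≢ r → adj G v (par v) ≡ true) where

  open Parent r par

  ChildOf : Fin n → Fin n → Set
  ChildOf a b = a ≢ r × par a ≡ b

  ChildOf⇒rk> : ∀ {a b} → ChildOf a b → rk b < rk a
  ChildOf⇒rk> {a} (a≢r , refl) = par-rk a a≢r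

  isChildOf⇒ChildOf : ∀ {a b} → isChildOf a b ≡ true → ChildOf a b
  isChildOf⇒ChildOf {a} {b} eq with a == r in a=r | b == par a in b=pa
  ... | false | true = ==-false⇒≢ a=r , sym (==⇒≡ b=pa)

  treeAdj : Fin n → Fin n → Bool
  treeAdj a b = isChildOf a b ∨ isChildOf b a

  ChildOf⇒treeAdj : ∀ {a b} → ChildOf a b → treeAdj a b ≡ true
  ChildOf⇒treeAdj {a} (a≢r , refl) rewrite ==-≢ a≢r | ==-refl (par a) = refl

  treeAdj⇒ : ∀ {a b} → treeAdj a b ≡ true → ChildOf a b ⊎ ChildOf b a
  treeAdj⇒ {a} {b} eq with isChildOf a b in ab | isChildOf b a in ba
  ... | true  | _    = inj₁ (isChildOf⇒ChildOf ab)
  ... | false | true = inj₂ (isChildOf⇒ChildOf ba)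

  ChildOf-asym : ∀ {a b} → ChildOf a b → ¬ ChildOf b a
  ChildOf-asym ab ba = <-asym (ChildOf⇒rk> ab) (ChildOf⇒rk> ba)

  treeAdj-irrefl : ∀ a → treeAdj a a ≡ false
  treeAdj-irrefl a with treeAdj a a in aa
  ... | false = refl
  ... | true with treeAdj⇒ {a} {a} aa
  ...   | inj₁ loop = ⊥-elim (ChildOf-asym loop loop)
  ...   | inj₂ loop = ⊥-elim (ChildOf-asym loop loop)

  T : Graph n
  T = record
    { adj = treeAdj ; sym = λ a b → ∨-comm (isChildOf a b) (isChildOf b a) ; irref = treeAdj-irrefl }

  T-spanning : SpanningSubgraph T G
  T-spanning a b eq with treeAdj⇒ {a} {b} eq
  ... | inj₁ (a≢r , refl) = par-adj a a≢r
  ... | inj₂ (b≢r , refl) = trans (adj-sym G (par b) b) (par-adj b b≢r)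

  walkToRoot : ∀ k v → rk v < k → Walk T v r
  walkToRoot (suc k) v (s≤s rk≤k) with v ≟ r
  ... | yes refl = [ r ]
  ... | no v≢r   = ChildOf⇒treeAdj (v≢r , refl) ∷ʷ walkToRoot k (par v) (≤-trans (par-rk v v≢r) rk≤k)

  T-connected : Connected T
  T-connected u v = walkToRoot _ u ≤-refl ++ʷ reverseʷ (walkToRoot _ v ≤-refl)

  degree-T : ∀ v → degree T v ≡ toℕ (not (v == r)) + children v
  degree-T v = begin
    degree T v                                           ≡⟨ degree≡count T v ⟩
    count (treeAdj v)                                    ≡⟨ count-∨ disjoint ⟩
    count (isChildOf v) + children v
      ≡⟨ cong (_+ children v) (toℕ-*-count (not (v == r)) (_== par v)) ⟨
    toℕ (not (v == r)) * count (_== par v) + children v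
      ≡⟨ cong (λ c → toℕ (not (v == r)) * c + children v) (count-== (par v)) ⟩
    toℕ (not (v == r)) * 1 + children v                  ≡⟨ cong (_+ children v) (*-identityʳ _) ⟩
    toℕ (not (v == r)) + children v                      ∎
    where
    open ≡-Reasoning
    disjoint : ∀ b → isChildOf v b ∧ isChildOf b v ≡ false
    disjoint b with isChildOf v b in vb | isChildOf b v in bv
    ... | false | _     = refl
    ... | true  | false = refl
    ... | true  | true  =
      ⊥-elim (ChildOf-asym (isChildOf⇒ChildOf {v} {b} vb) (isChildOf⇒ChildOf {b} {v} bv))

  Ascending : List (Fin n) → Set
  Ascending (a ∷ b ∷ ws) = ChildOf a b × Ascending (b ∷ ws)
  Ascending _            = ⊤

  Descending : List (Fin n) → Set
  Descending (a ∷ b ∷ ws) = ChildOf b a × Descending (b ∷ ws)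
  Descending _            = ⊤

  LastStepDescends : List (Fin n) → Set
  LastStepDescends (a ∷ b ∷ [])     = ChildOf b a
  LastStepDescends (a ∷ b ∷ c ∷ ws) = LastStepDescends (b ∷ c ∷ ws)
  LastStepDescends _                = ⊥

  -- A vertex has a single parent, so once a non-backtracking walk in T steps
  -- down it can never step up again.
  ascending-or-descendsLast : ∀ xs → IsPath T xs → NonBacktracking xs →
    Ascending xs ⊎ LastStepDescends xs
  ascending-or-descendsLast (a ∷ [])     _ _ = inj₁ tt
  ascending-or-descendsLast (a ∷ b ∷ []) (cons ab _) _ with treeAdj⇒ {a} {b} ab
  ... | inj₁ up   = inj₁ (up , tt)
  ... | inj₂ down = inj₂ down
  ascending-or-descendsLast (a ∷ b ∷ c ∷ ws) (cons ab p) (a≢c , nb)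
    with ascending-or-descendsLast (b ∷ c ∷ ws) p nb
  ... | inj₂ descends = inj₂ descends
  ... | inj₁ (b↑c , asc) with treeAdj⇒ {a} {b} ab
  ...   | inj₁ a↑b        = inj₁ (a↑b , b↑c , asc)
  ...   | inj₂ (_ , pb≡a) = ⊥-elim (a≢c (trans (sym pb≡a) (proj₂ b↑c)))

  descending-persists : ∀ a b ws → IsPath T (a ∷ b ∷ ws) → NonBacktracking (a ∷ b ∷ ws) →
    ChildOf b a → Descending (a ∷ b ∷ ws)
  descending-persists a b []       _                  _          b↓a = b↓a , tt
  descending-persists a b (c ∷ ws) (cons _ (cons bc p)) (a≢c , nb) b↓a with treeAdj⇒ {b} {c} bc
  ... | inj₁ (_ , pb≡c) = ⊥-elim (a≢c (trans (sym (proj₂ b↓a)) pb≡c))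
  ... | inj₂ c↓b        = b↓a , descending-persists b c ws (cons bc p) nb c↓b

  ascending⇒rk> : ∀ a xs → Ascending (a ∷ xs) → ∀ {z} → z ∈ xs → rk z < rk a
  ascending⇒rk> a (b ∷ ys) (a↑b , _)   (here refl) = ChildOf⇒rk> a↑b
  ascending⇒rk> a (b ∷ ys) (a↑b , asc) (there z∈) =
    <-trans (ascending⇒rk> b ys asc z∈) (ChildOf⇒rk> a↑b)

  descending⇒rk< : ∀ a xs → Descending (a ∷ xs) → ∀ {z} → z ∈ xs → rk a < rk z
  descending⇒rk< a (b ∷ ys) (b↓a , _)    (here refl) = ChildOf⇒rk> b↓a
  descending⇒rk< a (b ∷ ys) (b↓a , desc) (there z∈) =
    <-trans (ChildOf⇒rk> b↓a) (descending⇒rk< b ys desc z∈)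

  lastStepDescends-∷ʳ : ∀ xs {p q} → last xs ≡ just p → LastStepDescends (xs ++ q ∷ []) → ChildOf q p
  lastStepDescends-∷ʳ (x ∷ [])         refl q↓x = q↓x
  lastStepDescends-∷ʳ (x ∷ y ∷ [])     lst  d   = lastStepDescends-∷ʳ (y ∷ []) lst d
  lastStepDescends-∷ʳ (x ∷ y ∷ w ∷ ws) lst  d   = lastStepDescends-∷ʳ (y ∷ w ∷ ws) lst d

  -- Close the cycle into the walk v₀ v₁ … vₖ v₀. It cannot start by descending
  -- (it would descend throughout and never return to v₀), and it must end by
  -- descending (otherwise it ascends throughout), so v₁ = par v₀ = vₖ.
  no-cycle : ∀ v₀ v₁ x xs {vₖ} → Unique (v₀ ∷ v₁ ∷ x ∷ xs) → IsPath T (v₀ ∷ v₁ ∷ x ∷ xs) →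
    last (x ∷ xs) ≡ just vₖ → treeAdj vₖ v₀ ≡ true → ⊥
  no-cycle v₀ v₁ x xs {vₖ} (v₀∉ ∷ v₁∉ ∷ unique) path@(cons v₀v₁ _) lst closing =
    firstStep (treeAdj⇒ {v₀} {v₁} v₀v₁)
    where
    walk : IsPath T (v₀ ∷ v₁ ∷ x ∷ xs ++ v₀ ∷ [])
    walk = isPath-∷ʳ (v₀ ∷ v₁ ∷ x ∷ xs) path lst closing
    nb : NonBacktracking (v₀ ∷ v₁ ∷ x ∷ xs ++ v₀ ∷ [])
    nb = All.lookup v₀∉ (there (here refl))
       , unique-∷ʳ-nonBacktracking (v₁ ∷ x ∷ xs) v₀ (v₁∉ ∷ unique) v₀∉
    v₀∈ : v₀ ∈ v₁ ∷ x ∷ xs ++ v₀ ∷ []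
    v₀∈ = ∈-++⁺ʳ (v₁ ∷ x ∷ xs) (here refl)
    firstStep : ChildOf v₀ v₁ ⊎ ChildOf v₁ v₀ → ⊥
    firstStep (inj₂ v₁↓v₀) =
      <-irrefl refl (descending⇒rk< v₀ _ (descending-persists v₀ v₁ _ walk nb v₁↓v₀) v₀∈)
    firstStep (inj₁ (_ , pv₀≡v₁)) with ascending-or-descendsLast _ walk nb
    ... | inj₁ asc      = <-irrefl refl (ascending⇒rk> v₀ _ asc v₀∈)
    ... | inj₂ descends =
      All.lookup v₁∉ (last⇒∈ (x ∷ xs) lst)
        (trans (sym pv₀≡v₁) (proj₂ (lastStepDescends-∷ʳ (v₀ ∷ v₁ ∷ x ∷ xs) lst descends)))

  T-acyclic : Acyclic T
  T-acyclic record { rest = v₁ ∷ x ∷ xs ; shape = refl ; distinct = distinct ; path = path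
                   ; lastOf = lastOf ; closing = closing } =
    no-cycle _ v₁ x xs distinct path lastOf closing
  T-acyclic record { rest = [] ; shape = refl ; long = s≤s () }
  T-acyclic record { rest = _ ∷ [] ; shape = refl ; long = s≤s (s≤s ()) }

  oddSpanningTree : (∀ v → Odd (toℕ (not (v == r)) + children v)) → HasOddSpanningTree G
  oddSpanningTree odd =
    T , T-spanning , (T-connected , T-acyclic) , λ v → subst Odd (sym (degree-T v)) (odd v)

-- Growing the tree two leaves at a time

module Growth {n} (G : Graph n) (u : Fin n) where

  record PartialTree : Set where
    field
      inTree  : Fin n → Bool
      par     : Fin n → Fin n
      rk      : Fin n → ℕ
      root∈   : inTree u ≡ true
      par∈    : ∀ v → inTree v ≡ true → v ≢ u → inTree (par v) ≡ true
      par-rk  : ∀ v → inTree v ≡ true → v ≢ u → rk (par v) < rk v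
      par-adj : ∀ v → inTree v ≡ true → v ≢ u → adj G v (par v) ≡ true

    children : Fin n → ℕ
    children v = count (λ w → inTree w ∧ Parent.isChildOf u par w v)

    OddDegrees : Set
    OddDegrees = ∀ v → inTree v ≡ true → Odd (toℕ (not (v == u)) + children v)

    ∉⇒≢ : ∀ {v w} → inTree v ≡ true → inTree w ≡ false → v ≢ w
    ∉⇒≢ v∈ w∉ refl = true≢false (trans (sym v∈) w∉)

  open PartialTree

  singleton : PartialTree
  singleton = record
    { inTree = _== u ; par = λ _ → u ; rk = λ _ → 0 ; root∈ = ==-refl u
    ; par∈ = λ v v=u v≢u → ⊥-elim (v≢u (==⇒≡ v=u))
    ; par-rk = λ v v=u v≢u → ⊥-elim (v≢u (==⇒≡ v=u))
    ; par-adj = λ v v=u v≢u → ⊥-elim (v≢u (==⇒≡ v=u)) }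

  singleton-children : ∀ v → children singleton v ≡ 0
  singleton-children v = trans (count-cong childless) (count-false n)
    where
    childless : ∀ w → (w == u) ∧ (not (w == u) ∧ (v == u)) ≡ false
    childless w with w == u
    ... | true  = refl
    ... | false = refl

  module Graft (P : PartialTree) (s : Fin n) (N : Fin n → Bool) (s∈ : inTree P s ≡ true)
    (N-new : ∀ w → N w ≡ true → inTree P w ≡ false)
    (N-adj : ∀ w → N w ≡ true → adj G s w ≡ true) where

    N≢u : ∀ {w} → N w ≡ true → w ≢ u
    N≢u {w} Nw w≡u = ∉⇒≢ P (root∈ P) (N-new w Nw) (sym w≡u)

    N-old : ∀ {w} → inTree P w ≡ true → N w ≡ false
    N-old {w} w∈ with N w in Nw
    ... | false = refl
    ... | true  = ⊥-elim (∉⇒≢ P w∈ (N-new w Nw) refl)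

    inOld : ∀ {w} → inTree P w ∨ false ≡ true → inTree P w ≡ true
    inOld {w} = trans (sym (∨-identityʳ (inTree P w)))

    grafted : PartialTree
    grafted = record
      { inTree  = λ w → inTree P w ∨ N w
      ; par     = λ w → if N w then s else par P w
      ; rk      = λ w → if N w then suc (rk P s) else rk P w
      ; root∈   = cong (_∨ N u) (root∈ P)
      ; par∈    = par∈′
      ; par-rk  = par-rk′
      ; par-adj = par-adj′ }
      where
      par∈′ : ∀ v → inTree P v ∨ N v ≡ true → v ≢ u →
        inTree P (if N v then s else par P v) ∨ N (if N v then s else par P v) ≡ true
      par∈′ v v∈ v≢u with N v in Nv
      ... | true  rewrite s∈ = refl
      ... | false rewrite par∈ P v (inOld v∈) v≢u = refl
      par-rk′ : ∀ v → inTree P v ∨ N v ≡ true → v ≢ u →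
        (if N (if N v then s else par P v) then suc (rk P s) else rk P (if N v then s else par P v))
          < (if N v then suc (rk P s) else rk P v)
      par-rk′ v v∈ v≢u with N v in Nv
      ... | true  rewrite N-old s∈ = ≤-refl
      ... | false rewrite N-old (par∈ P v (inOld v∈) v≢u) = par-rk P v (inOld v∈) v≢u
      par-adj′ : ∀ v → inTree P v ∨ N v ≡ true → v ≢ u → adj G v (if N v then s else par P v) ≡ true
      par-adj′ v v∈ v≢u with N v in Nv
      ... | true  = trans (adj-sym G v s) (N-adj v Nv)
      ... | false = par-adj P v (inOld v∈) v≢u

    children-grafted : ∀ v → children grafted v ≡ children P v + toℕ (v == s) * count N
    children-grafted v = begin
      children grafted v
        ≡⟨ sum-cong-≗ split ⟩
      ∑[ w < n ] (toℕ (isChild w) + toℕ ((v == s) ∧ N w))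
        ≡⟨ ∑-distrib-+ (toℕ ∘ isChild) (λ w → toℕ ((v == s) ∧ N w)) ⟩
      children P v + count (λ w → (v == s) ∧ N w)
        ≡⟨ cong (children P v +_) (toℕ-*-count (v == s) N) ⟨
      children P v + toℕ (v == s) * count N ∎
      where
      open ≡-Reasoning
      isChild : Fin n → Bool
      isChild w = inTree P w ∧ (not (w == u) ∧ (v == par P w))
      split : ∀ w → toℕ ((inTree P w ∨ N w) ∧ (not (w == u) ∧ (v == (if N w then s else par P w))))
                  ≡ toℕ (isChild w) + toℕ ((v == s) ∧ N w)
      split w with N w in Nw
      ... | true  rewrite N-new w Nw | ==-≢ (N≢u Nw) | ∧-identityʳ (v == s) = refl
      ... | false rewrite ∨-identityʳ (inTree P w) | ∧-zeroʳ (v == s) = sym (+-identityʳ _)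

    children-leaf : ∀ v → N v ≡ true → children grafted v ≡ 0
    children-leaf v Nv = trans (count-cong childless) (count-false n)
      where
      v∉ = N-new v Nv
      childless : ∀ w → (inTree P w ∨ N w) ∧ (not (w == u) ∧ (v == (if N w then s else par P w))) ≡ false
      childless w with N w
      ... | true rewrite ==-≢ (≢-sym (∉⇒≢ P s∈ v∉)) | ∧-zeroʳ (not (w == u)) = ∧-zeroʳ _
      ... | false with inTree P w in w∈ | w == u in w=u
      ...   | false | _     = refl
      ...   | true  | true  = refl
      ...   | true  | false rewrite ==-≢ (≢-sym (∉⇒≢ P (par∈ P w w∈ (==-false⇒≢ w=u)) v∉)) = refl

    leaf-odd : ∀ v → N v ≡ true → Odd (toℕ (not (v == u)) + children grafted v)
    leaf-odd v Nv rewrite ==-≢ (N≢u Nv) | children-leaf v Nv = refl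

    outside-grafted : count (not ∘ inTree grafted) + count N ≡ count (not ∘ inTree P)
    outside-grafted = trans (sym (count-∨ disjoint)) (count-cong merge)
      where
      disjoint : ∀ w → not (inTree P w ∨ N w) ∧ N w ≡ false
      disjoint w with N w
      ... | true  rewrite ∨-zeroʳ (inTree P w) = refl
      ... | false = ∧-zeroʳ _
      merge : ∀ w → not (inTree P w ∨ N w) ∨ N w ≡ not (inTree P w)
      merge w with N w in Nw
      ... | true  rewrite N-new w Nw = refl
      ... | false rewrite ∨-identityʳ (inTree P w) = ∨-identityʳ _

    grafted-odd : OddDegrees P → count N ≡ 2 → OddDegrees grafted
    grafted-odd odd N₂ v v∈ with N v in Nv
    ... | true  = leaf-odd v Nv
    ... | false rewrite children-grafted v | N₂ =
      trans (cong (_% 2) (sym (+-assoc d (children P v) _)))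
            (trans ([m+kn]%n≡m%n (d + children P v) (toℕ (v == s)) 2) (odd v (inOld v∈)))
      where d = toℕ (not (v == u))

  covering⇒oddSpanningTree : (P : PartialTree) → OddDegrees P → count (not ∘ inTree P) ≡ 0 →
    HasOddSpanningTree G
  covering⇒oddSpanningTree P odd none =
    ParentTree.oddSpanningTree G u (par P) (rk P) (λ v → par-rk P v (all v)) (λ v → par-adj P v (all v))
      odd′
    where
    all : ∀ v → inTree P v ≡ true
    all v = trans (sym (not-involutive _)) (cong not (count≡0⇒ (not ∘ inTree P) none v))
    odd′ : ∀ v → Odd (toℕ (not (v == u)) + Parent.children u (par P) v)
    odd′ v = subst (λ c → Odd (toℕ (not (v == u)) + c))
                   (count-cong (λ w → cong (_∧ _) (all w))) (odd v (all v))

  attachPair : (P : PartialTree) → OddDegrees P → ∀ {s x y} → inTree P s ≡ true → x ≢ y →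
    adj G s x ≡ true → adj G s y ≡ true → inTree P x ≡ false → inTree P y ≡ false →
    Σ PartialTree λ P′ → OddDegrees P′ × count (not ∘ inTree P′) + 2 ≡ count (not ∘ inTree P)
  attachPair P odd {s} {x} {y} s∈ x≢y sx sy x∉ y∉ =
    grafted , grafted-odd odd pair
            , subst (λ c → count (not ∘ inTree grafted) + c ≡ _) pair outside-grafted
    where
    N : Fin n → Bool
    N w = (w == x) ∨ (w == y)
    onPair : (A : Fin n → Set) → A x → A y → ∀ w → N w ≡ true → A w
    onPair A Ax Ay w Nw with w == x in w=x | w == y in w=y
    ... | true  | _    = subst A (sym (==⇒≡ w=x)) Ax
    ... | false | true = subst A (sym (==⇒≡ w=y)) Ay
    disjoint : ∀ w → (w == x) ∧ (w == y) ≡ false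
    disjoint w with w == x in w=x
    ... | false = refl
    ... | true rewrite ==⇒≡ {x = w} {x} w=x = ==-≢ x≢y
    pair : count N ≡ 2
    pair = trans (count-∨ disjoint) (cong₂ _+_ (count-== x) (count-== y))
    open Graft P s N s∈ (onPair (λ w → inTree P w ≡ false) x∉ y∉) (onPair (λ w → adj G s w ≡ true) sx sy)

  star : (K : Fin n → Bool) → (∀ w → K w ≡ true → adj G u w ≡ true) → Odd (count K) →
    Σ PartialTree λ P → OddDegrees P × count (not ∘ inTree P) + suc (count K) ≡ n
  star K K-adj oddK = grafted , odd , size
    where
    K-new : ∀ w → K w ≡ true → inTree singleton w ≡ false
    K-new w Kw = ==-≢ {x = w} {u} λ { refl → true≢false (trans (sym (K-adj u Kw)) (irref G u)) }
    open Graft singleton u K (==-refl u) K-new K-adj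
    odd : OddDegrees grafted
    odd v v∈ with K v in Kv
    ... | true  = leaf-odd v Kv
    ... | false with ==⇒≡ {x = v} {u} (trans (sym (∨-identityʳ _)) v∈)
    ...   | refl rewrite children-grafted u | singleton-children u | ==-refl u =
            subst Odd (sym (+-identityʳ (count K))) oddK
    size : count (not ∘ inTree grafted) + suc (count K) ≡ n
    size = begin
      count (not ∘ inTree grafted) + suc (count K)   ≡⟨ +-suc _ (count K) ⟩
      suc (count (not ∘ inTree grafted) + count K)   ≡⟨ cong suc outside-grafted ⟩
      1 + count (not ∘ (_== u))                      ≡⟨ cong (_+ count (not ∘ (_== u))) (count-== u) ⟨
      count (_== u) + count (not ∘ (_== u))          ≡⟨ count-complement (_== u) ⟩
      n                                              ∎
      where open ≡-Reasoning

  module _ {h} (n≡h+h : n ≡ h + h) (δ≥ : MinDegreeAtLeast G (h + 1)) where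

    h+1≤deg[u] : h + 1 ≤ count (adj G u)
    h+1≤deg[u] = subst (h + 1 ≤_) (degree≡count G u) (δ≥ u)

    grow : ∀ k (P : PartialTree) → OddDegrees P → count (not ∘ inTree P) ≡ k + k → k + k + 1 ≤ h →
      HasOddSpanningTree G
    grow zero    P odd none _ = covering⇒oddSpanningTree P odd none
    grow (suc k) P odd outside fits
      with branching-vertex G n≡h+h δ≥ (inTree P)
             (subst (2 ≤_) (sym (trans outside (double-suc k))) (m≤n+m 2 (k + k)))
             (subst (λ m → m + 1 ≤ h) (sym outside) fits)
    ... | s , s∈ , 2≤deg with count≥2⇒ _ 2≤deg
    ... | x , y , x≢y , sx , sy with ∧-true⇒ sx | ∧-true⇒ sy
    ... | sx , x∉ | sy , y∉ with attachPair P odd s∈ x≢y sx sy (not-true⇒ x∉) (not-true⇒ y∉)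
    ... | P′ , odd′ , shrinks =
      grow k P′ odd′ (+-cancelʳ-≡ 2 _ (k + k) (trans shrinks (trans outside (double-suc k)))) fits′
      where
      fits′ : k + k + 1 ≤ h
      fits′ = ≤-trans (+-monoˡ-≤ 1 (+-mono-≤ (n≤1+n k) (n≤1+n k))) fits

    growFromStar : (P : PartialTree) → OddDegrees P → ∀ c → Odd c → h ≤ c →
      count (not ∘ inTree P) + suc c ≡ n → HasOddSpanningTree G
    growFromStar P odd c odd-c h≤c size with odd⇒suc-double odd-c
    ... | j , c+1≡j+j
      with +-double-cancel _ j h (trans (cong (count (not ∘ inTree P) +_) (sym c+1≡j+j)) (trans size n≡h+h))
    ... | k , outside = grow k P odd outside (+-cancelʳ-≤ h (k + k + 1) h fits)
      where
      fits : k + k + 1 + h ≤ h + h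
      fits = begin
        k + k + 1 + h                    ≤⟨ +-monoʳ-≤ (k + k + 1) h≤c ⟩
        k + k + 1 + c                    ≡⟨ +-assoc (k + k) 1 c ⟩
        k + k + suc c                    ≡⟨ cong (_+ suc c) outside ⟨
        count (not ∘ inTree P) + suc c   ≡⟨ trans size n≡h+h ⟩
        h + h                            ∎
        where open ≤-Reasoning

    oddSpanningTree : HasOddSpanningTree G
    oddSpanningTree with odd-subset (adj G u) (≤-trans (m≤n+m 1 h) h+1≤deg[u])
    ... | K , K⊆N[u] , odd-K , deg≤ with star K K⊆N[u] odd-K
    ... | P , odd , size = growFromStar P odd (count K) odd-K h≤K size
      where
      h≤K : h ≤ count K
      h≤K = ≤-pred (≤-trans (≤-reflexive (+-comm 1 h)) (≤-trans h+1≤deg[u] deg≤))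

theorem2p6 : (n : ℕ) → 1 ≤ n → n % 2 ≡ 0 → (G : Graph n) → Connected G →
    MinDegreeAtLeast G (n / 2 + 1) → HasOddSpanningTree G
theorem2p6 (suc n) _ even G _ δ≥ = Growth.oddSpanningTree G zero (even⇒double even) δ≥
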